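{- The exponential generating function $R_1(z)=\sum_{n\ge0}r_{1,n}\frac{z^n}{n!}$ of relaxed trees of right height at most $1$ is D-finite and satisfies $(1-2z)R_1'(z)-R_1(z)=0$, $R_1(0)=1$. Moreover $R_1(z)=\frac{1}{\sqrt{1-2z}}$ and $r_{1,n}=(2n-1)!!$ for all $n\ge0$.
   Context: $m!!=\prod_{j=0}^{\lfloor (m-1)/2\rfloor}(m-2j)$ (so $(-1)!!=1$). A relaxed tree of size $n$: take a full binary tree $T$ (each node $0$ or $2$ ordered children) with $n$ internal nodes, traverse in post-order (left, right, node); keep the first leaf as the sink and replace every other leaf $\lambda$ by a pointer to a node (internal node or sink) visited before $\lambda$; relaxed trees are equal iff same $T$ and same targets. The spine is the binary tree of internal nodes of $T$ with the tree edges between them; the right height is the maximal number of right edges on a spine path from the root. $r_{1,n}$ counts relaxed trees of size $n$ with right height at most $1$. -}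

module Defs where

open import Data.Nat using (ℕ; zero; suc; _+_; _*_; _∸_; _⊔_; _≟_; _≤?_)
open import Data.Bool using (Bool; true; false)
open import Data.List using (List; []; _∷_; _++_; [_]; map; concatMap; filter; length)
open import Data.Product using (_×_; _,_; proj₁)

data BT : Set where
  lf : BT
  nd : BT → BT → BT

internal : BT → ℕ
internal lf       = 0
internal (nd l r) = suc (internal l + internal r)

treesDepth : ℕ → List BT
treesDepth zero    = [ lf ]
treesDepth (suc d) = lf ∷ concatMap (λ l → map (nd l) (treesDepth d)) (treesDepth d)

-- all full binary trees with exactly n internal nodes (their depth is ≤ n)
trees : ℕ → List BT
trees n = filter (λ t → internal t ≟ n) (treesDepth n)

-- post-order traversal (left, right, node); true = internal node, false = leaf
postorder : BT → List Bool
postorder lf       = [ false ]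
postorder (nd l r) = postorder l ++ postorder r ++ [ true ]

-- Enumerate pointer assignments along the post-order sequence.
-- avail = post-order positions of the nodes visited so far that may be targets
-- (the sink and internal nodes); j = current position.
-- An assignment is the list of target positions of the non-sink leaves, in post-order.
assignGo : List ℕ → ℕ → List Bool → List (List ℕ)
assignGo avail j []            = [ [] ]
assignGo avail j (true ∷ ts)   = assignGo (avail ++ [ j ]) (suc j) ts
assignGo avail j (false ∷ ts)  =
  concatMap (λ p → map (p ∷_) (assignGo avail (suc j) ts)) avail

-- the first position is always a leaf (the sink, position 0)
assignments : List Bool → List (List ℕ)
assignments (false ∷ ts) = assignGo [ 0 ] 1 ts
assignments _            = []

-- A relaxed tree: underlying full binary tree together with the targets of
-- its non-sink leaves (as post-order positions).
RelaxedTree : Set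
RelaxedTree = BT × List ℕ

relaxedTrees : ℕ → List RelaxedTree
relaxedTrees n = concatMap (λ t → map (t ,_) (assignments (postorder t))) (trees n)

-- right height of the spine (binary tree of internal nodes):
-- maximal number of right edges on a spine path from the root (0 for empty spine)
rightHeight : BT → ℕ
rightHeight lf                  = 0
rightHeight (nd l lf)           = rightHeight l
rightHeight (nd l r@(nd _ _))   = rightHeight l ⊔ suc (rightHeight r)

r₁ : ℕ → ℕ
r₁ n = length (filter (λ x → rightHeight (proj₁ x) ≤? 1) (relaxedTrees n))

dfact : ℕ → ℕ
dfact zero          = 1
dfact (suc zero)    = 1
dfact (suc (suc m)) = suc (suc m) * dfact m

{-# OPTIONS --safe #-}
-- Choosing the targets leaf by leaf in post-order, the relaxed trees on a shape t number the
-- product over its leaves of the nodes available to each leaf, i.e. one plus the number of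
-- internal nodes visited before it. A shape with n + 1 internal nodes and right height at
-- most 1 arises in exactly one way from such a shape t with n internal nodes: as nd t lf,
-- whose new leaf has n + 1 targets, or, if t = nd l r, as nd l (nd r lf), whose new leaf has
-- n targets; the other leaves keep their targets. Hence r₁ (n + 1) = (n + 1 + n) r₁ n.

module Submission where

open import Defs
open import Data.Nat using (ℕ; suc; _+_; _*_; _∸_)
open import Data.Product using (_×_)
open import Relation.Binary.PropositionalEquality using (_≡_)

open import Data.Nat using (zero; _<_; _⊔_; z≤n; s≤s; _≟_; _≤?_)
open import Data.Nat.Properties
  using (+-identityʳ; +-comm; +-assoc; *-assoc; *-comm; *-identityʳ; *-distribˡ-+; *-zeroʳ; *-suc;
         ≤-trans; m≤m+n; m≤n+m; m≤n⊔m; n≤1+n; >⇒≢; <⇒≱)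
open import Data.Nat.Tactic.RingSolver using (solve-∀)
open import Data.Bool using (Bool; true; false)
open import Data.List using (List; []; _∷_; _++_; [_]; map; concatMap; filter; length)
open import Data.List.Properties using (length-++; length-map; ++-assoc; ++-identityʳ; filter-++)
open import Data.Product using (_,_; proj₁)
open import Function using (_∘_)
open import Relation.Nullary using (does; yes; no)
open import Relation.Nullary.Decidable using (dec-false)
open import Relation.Unary using (Pred; Decidable)
open import Relation.Binary.PropositionalEquality
  using (_≢_; refl; sym; trans; cong; cong₂; module ≡-Reasoning)

open ≡-Reasoning

∑ : {A : Set} → List A → (A → ℕ) → ℕ
∑ []       f = 0
∑ (x ∷ xs) f = f x + ∑ xs f

𝟙 : Bool → ℕ
𝟙 true  = 1
𝟙 false = 0

module _ {A : Set} where

  ∑-cong : {f g : A → ℕ} → (∀ x → f x ≡ g x) → ∀ xs → ∑ xs f ≡ ∑ xs g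
  ∑-cong f≗g []       = refl
  ∑-cong f≗g (x ∷ xs) = cong₂ _+_ (f≗g x) (∑-cong f≗g xs)

  ∑-zero : {f : A → ℕ} → (∀ x → f x ≡ 0) → ∀ xs → ∑ xs f ≡ 0
  ∑-zero f≗0 []       = refl
  ∑-zero f≗0 (x ∷ xs) = cong₂ _+_ (f≗0 x) (∑-zero f≗0 xs)

  ∑-+ : ∀ xs (f g : A → ℕ) → ∑ xs (λ x → f x + g x) ≡ ∑ xs f + ∑ xs g
  ∑-+ []       f g = refl
  ∑-+ (x ∷ xs) f g = trans (cong (f x + g x +_) (∑-+ xs f g)) (interchange (f x) (g x) _ _)
    where
    interchange : ∀ a b c d → a + b + (c + d) ≡ a + c + (b + d)
    interchange = solve-∀

  ∑-*ˡ : ∀ c xs (f : A → ℕ) → ∑ xs (λ x → c * f x) ≡ c * ∑ xs f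
  ∑-*ˡ c []       f = sym (*-zeroʳ c)
  ∑-*ˡ c (x ∷ xs) f = trans (cong (c * f x +_) (∑-*ˡ c xs f)) (sym (*-distribˡ-+ c (f x) _))

  ∑-++ : ∀ xs ys (f : A → ℕ) → ∑ (xs ++ ys) f ≡ ∑ xs f + ∑ ys f
  ∑-++ []       ys f = refl
  ∑-++ (x ∷ xs) ys f = trans (cong (f x +_) (∑-++ xs ys f)) (sym (+-assoc (f x) _ _))

  ∑-filter : ∀ {p} {P : Pred A p} (P? : Decidable P) (xs : List A) (f : A → ℕ) →
             ∑ (filter P? xs) f ≡ ∑ xs (λ x → 𝟙 (does (P? x)) * f x)
  ∑-filter P? []       f = refl
  ∑-filter P? (x ∷ xs) f with does (P? x)
  ... | true  = cong₂ _+_ (sym (+-identityʳ (f x))) (∑-filter P? xs f)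
  ... | false = ∑-filter P? xs f

module _ {A B : Set} where

  ∑-map : ∀ (g : A → B) xs (f : B → ℕ) → ∑ (map g xs) f ≡ ∑ xs (f ∘ g)
  ∑-map g []       f = refl
  ∑-map g (x ∷ xs) f = cong (f (g x) +_) (∑-map g xs f)

  ∑-concatMap : ∀ (g : A → List B) xs (f : B → ℕ) →
                ∑ (concatMap g xs) f ≡ ∑ xs (λ x → ∑ (g x) f)
  ∑-concatMap g []       f = refl
  ∑-concatMap g (x ∷ xs) f = trans (∑-++ (g x) _ f) (cong (∑ (g x) f +_) (∑-concatMap g xs f))

  length-concatMap-const : ∀ {k} (g : A → List B) → (∀ x → length (g x) ≡ k) →
                           ∀ xs → length (concatMap g xs) ≡ length xs * k
  length-concatMap-const g len-g []       = refl
  length-concatMap-const g len-g (x ∷ xs) =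
    trans (length-++ (g x)) (cong₂ _+_ (len-g x) (length-concatMap-const g len-g xs))

  length-filter-concatMap : ∀ {p} {P : Pred B p} (P? : Decidable P) (g : A → List B) (xs : List A) →
    length (filter P? (concatMap g xs)) ≡ ∑ xs (λ x → length (filter P? (g x)))
  length-filter-concatMap P? g []       = refl
  length-filter-concatMap P? g (x ∷ xs) = begin
    length (filter P? (g x ++ concatMap g xs))
      ≡⟨ cong length (filter-++ P? (g x) _) ⟩
    length (filter P? (g x) ++ filter P? (concatMap g xs))
      ≡⟨ length-++ (filter P? (g x)) ⟩
    length (filter P? (g x)) + length (filter P? (concatMap g xs))
      ≡⟨ cong (length (filter P? (g x)) +_) (length-filter-concatMap P? g xs) ⟩
    length (filter P? (g x)) + ∑ xs (λ x → length (filter P? (g x))) ∎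

assignCount : ℕ → List Bool → ℕ
assignCount a []           = 1
assignCount a (true  ∷ bs) = assignCount (suc a) bs
assignCount a (false ∷ bs) = a * assignCount a bs

-- The product over the leaves of t of a plus the number of internal nodes preceding the leaf
-- in post-order: the number of targets available to it when a targets precede t.
leafChoices : ℕ → BT → ℕ
leafChoices a lf       = a
leafChoices a (nd l r) = leafChoices a l * leafChoices (a + internal l) r

length-assignGo : ∀ avail j bs → length (assignGo avail j bs) ≡ assignCount (length avail) bs
length-assignGo avail j []           = refl
length-assignGo avail j (true  ∷ bs) = begin
  length (assignGo (avail ++ [ j ]) (suc j) bs) ≡⟨ length-assignGo (avail ++ [ j ]) (suc j) bs ⟩
  assignCount (length (avail ++ [ j ])) bs      ≡⟨ cong (λ k → assignCount k bs) (length-++ avail) ⟩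
  assignCount (length avail + 1) bs             ≡⟨ cong (λ k → assignCount k bs) (+-comm (length avail) 1) ⟩
  assignCount (suc (length avail)) bs           ∎
length-assignGo avail j (false ∷ bs) =
  trans (length-concatMap-const (λ p → map (p ∷_) rest) (λ p → length-map (p ∷_) rest) avail)
        (cong (length avail *_) (length-assignGo avail (suc j) bs))
  where rest = assignGo avail (suc j) bs

assignCount-postorder : ∀ a t bs →
  assignCount a (postorder t ++ bs) ≡ leafChoices a t * assignCount (a + internal t) bs
assignCount-postorder a lf       bs = cong (λ k → a * assignCount k bs) (sym (+-identityʳ a))
assignCount-postorder a (nd l r) bs = begin
  assignCount a ((postorder l ++ postorder r ++ [ true ]) ++ bs)
    ≡⟨ cong (assignCount a) (++-assoc (postorder l) (postorder r ++ [ true ]) bs) ⟩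
  assignCount a (postorder l ++ (postorder r ++ [ true ]) ++ bs)
    ≡⟨ cong (assignCount a ∘ (postorder l ++_)) (++-assoc (postorder r) [ true ] bs) ⟩
  assignCount a (postorder l ++ postorder r ++ true ∷ bs)
    ≡⟨ assignCount-postorder a l _ ⟩
  leafChoices a l * assignCount (a + internal l) (postorder r ++ true ∷ bs)
    ≡⟨ cong (leafChoices a l *_) (assignCount-postorder (a + internal l) r _) ⟩
  leafChoices a l * (leafChoices (a + internal l) r * assignCount (suc (a + internal l + internal r)) bs)
    ≡⟨ sym (*-assoc (leafChoices a l) _ _) ⟩
  leafChoices a (nd l r) * assignCount (suc (a + internal l + internal r)) bs
    ≡⟨ cong (λ k → leafChoices a (nd l r) * assignCount k bs) (size-shift a (internal l) (internal r)) ⟩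
  leafChoices a (nd l r) * assignCount (a + internal (nd l r)) bs ∎
  where
  size-shift : ∀ a b c → suc (a + b + c) ≡ a + suc (b + c)
  size-shift = solve-∀

-- The sink is the first leaf in post-order and has no choice to make; counting it as a leaf
-- with one available target (itself) gives the same number.
length-assignments-postorder-++ : ∀ t bs →
  length (assignments (postorder t ++ bs)) ≡ assignCount 1 (postorder t ++ bs)
length-assignments-postorder-++ lf       bs = trans (length-assignGo [ 0 ] 1 bs) (sym (+-identityʳ _))
length-assignments-postorder-++ (nd l r) bs =
  trans (cong (length ∘ assignments) eq)
        (trans (length-assignments-postorder-++ l _) (cong (assignCount 1) (sym eq)))
  where eq = ++-assoc (postorder l) (postorder r ++ [ true ]) bs

length-assignments-postorder : ∀ t → length (assignments (postorder t)) ≡ leafChoices 1 t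
length-assignments-postorder t = begin
  length (assignments (postorder t))        ≡⟨ cong (length ∘ assignments) (sym (++-identityʳ (postorder t))) ⟩
  length (assignments (postorder t ++ []))  ≡⟨ length-assignments-postorder-++ t [] ⟩
  assignCount 1 (postorder t ++ [])         ≡⟨ assignCount-postorder 1 t [] ⟩
  leafChoices 1 t * 1                       ≡⟨ *-identityʳ _ ⟩
  leafChoices 1 t                           ∎

relaxedCount₁ : BT → ℕ
relaxedCount₁ t = 𝟙 (does (rightHeight t ≤? 1)) * leafChoices 1 t

length-filter-shape : ∀ t (X : List (List ℕ)) →
  length (filter (λ x → rightHeight (proj₁ x) ≤? 1) (map (t ,_) X))
  ≡ 𝟙 (does (rightHeight t ≤? 1)) * length X
length-filter-shape t []      = sym (*-zeroʳ (𝟙 (does (rightHeight t ≤? 1))))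
length-filter-shape t (x ∷ X) with does (rightHeight t ≤? 1) | length-filter-shape t X
... | true  | ih = cong suc ih
... | false | ih = ih

r₁≡∑ : ∀ n → r₁ n ≡ ∑ (trees n) relaxedCount₁
r₁≡∑ n = trans (length-filter-concatMap _ _ (trees n)) (∑-cong shape (trees n))
  where
  shape : ∀ t →
    length (filter (λ x → rightHeight (proj₁ x) ≤? 1) (map (t ,_) (assignments (postorder t))))
    ≡ relaxedCount₁ t
  shape t = trans (length-filter-shape t (assignments (postorder t)))
                  (cong (𝟙 (does (rightHeight t ≤? 1)) *_) (length-assignments-postorder t))

∑-treesDepth-suc : ∀ d (h : BT → ℕ) →
  ∑ (treesDepth (suc d)) h ≡ h lf + ∑ (treesDepth d) (λ l → ∑ (treesDepth d) (λ r → h (nd l r)))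
∑-treesDepth-suc d h = cong (h lf +_) (trans (∑-concatMap _ (treesDepth d) h)
  (∑-cong (λ l → ∑-map (nd l) (treesDepth d) h) (treesDepth d)))

∑-treesDepth-lf : ∀ d (h : BT → ℕ) → (∀ l r → h (nd l r) ≡ 0) → ∑ (treesDepth d) h ≡ h lf
∑-treesDepth-lf zero    h h-nd≡0 = +-identityʳ (h lf)
∑-treesDepth-lf (suc d) h h-nd≡0 = begin
  ∑ (treesDepth (suc d)) h                                         ≡⟨ ∑-treesDepth-suc d h ⟩
  h lf + ∑ (treesDepth d) (λ l → ∑ (treesDepth d) (λ r → h (nd l r)))
    ≡⟨ cong (h lf +_) (∑-zero (λ l → ∑-zero (h-nd≡0 l) (treesDepth d)) (treesDepth d)) ⟩
  h lf + 0                                                         ≡⟨ +-identityʳ (h lf) ⟩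
  h lf                                                             ∎

-- Every tree with at most d internal nodes has depth at most d, so it already occurs in
-- treesDepth d.
∑-treesDepth-stable : ∀ d (h : BT → ℕ) → (∀ t → d < internal t → h t ≡ 0) →
  ∑ (treesDepth (suc d)) h ≡ ∑ (treesDepth d) h
∑-treesDepth-stable zero    h large≡0 = cong (λ x → h lf + (x + 0)) (large≡0 (nd lf lf) (s≤s z≤n))
∑-treesDepth-stable (suc d) h large≡0 = begin
  ∑ (treesDepth (suc (suc d))) h
    ≡⟨ ∑-treesDepth-suc (suc d) h ⟩
  h lf + ∑ (treesDepth (suc d)) (λ l → ∑ (treesDepth (suc d)) (λ r → h (nd l r)))
    ≡⟨ cong (h lf +_) (∑-cong (λ l → ∑-treesDepth-stable d _ (λ r d<r →
         large≡0 (nd l r) (s≤s (≤-trans d<r (m≤n+m (internal r) (internal l)))))) (treesDepth (suc d))) ⟩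
  h lf + ∑ (treesDepth (suc d)) (λ l → ∑ (treesDepth d) (λ r → h (nd l r)))
    ≡⟨ cong (h lf +_) (∑-treesDepth-stable d _ (λ l d<l → ∑-zero (λ r →
         large≡0 (nd l r) (s≤s (≤-trans d<l (m≤m+n (internal l) (internal r))))) (treesDepth d))) ⟩
  h lf + ∑ (treesDepth d) (λ l → ∑ (treesDepth d) (λ r → h (nd l r)))
    ≡⟨ sym (∑-treesDepth-suc d h) ⟩
  ∑ (treesDepth (suc d)) h ∎

atSize : ℕ → (BT → ℕ) → BT → ℕ
atSize n h t = 𝟙 (does (internal t ≟ n)) * h t

atSize-≢ : ∀ n h t → internal t ≢ n → atSize n h t ≡ 0
atSize-≢ n h t t≢n = cong (λ b → 𝟙 b * h t) (dec-false (internal t ≟ n) t≢n)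

atSize-cong : ∀ n {f g : BT → ℕ} → (∀ t → internal t ≡ n → f t ≡ g t) →
              ∀ t → atSize n f t ≡ atSize n g t
atSize-cong n {f} {g} f≗g t with internal t ≟ n
... | yes t≡n = cong (𝟙 (does (internal t ≟ n)) *_) (f≗g t t≡n)
... | no  t≢n = trans (atSize-≢ n f t t≢n) (sym (atSize-≢ n g t t≢n))

atSize-zero : ∀ n h t → h t ≡ 0 → atSize n h t ≡ 0
atSize-zero n h t ht≡0 =
  trans (cong (𝟙 (does (internal t ≟ n)) *_) ht≡0) (*-zeroʳ (𝟙 (does (internal t ≟ n))))

∑-trees : ∀ n h → ∑ (trees n) h ≡ ∑ (treesDepth n) (atSize n h)
∑-trees n h = ∑-filter (λ t → internal t ≟ n) (treesDepth n) h

∑-trees-deeper : ∀ n h → ∑ (trees n) h ≡ ∑ (treesDepth (suc n)) (atSize n h)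
∑-trees-deeper n h = trans (∑-trees n h)
  (sym (∑-treesDepth-stable n (atSize n h) (λ t n<t → atSize-≢ n h t (>⇒≢ n<t))))

∑-trees-cong : ∀ n {f g : BT → ℕ} → (∀ t → internal t ≡ n → f t ≡ g t) →
               ∑ (trees n) f ≡ ∑ (trees n) g
∑-trees-cong n {f} {g} f≗g =
  trans (∑-trees n f) (trans (∑-cong (atSize-cong n f≗g) (treesDepth n)) (sym (∑-trees n g)))

-- A leaf has no root under which to graft, hence the value 0.
atGraft : (BT → ℕ) → BT → ℕ
atGraft h lf       = 0
atGraft h (nd l r) = h (nd l (nd r lf))

internal-graft : ∀ l r → internal (nd l (nd r lf)) ≡ suc (internal (nd l r))
internal-graft l r = shift (internal l) (internal r)
  where
  shift : ∀ a b → suc (a + suc (b + 0)) ≡ suc (suc (a + b))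
  shift = solve-∀

∑-trees-root : ∀ n h →
  ∑ (treesDepth (suc n)) (λ l → atSize (suc n) h (nd l lf)) ≡ ∑ (trees n) (λ t → h (nd t lf))
∑-trees-root n h =
  trans (∑-cong (λ l → cong (λ k → 𝟙 (does (k ≟ n)) * h (nd l lf)) (+-identityʳ (internal l)))
                (treesDepth (suc n)))
        (sym (∑-trees-deeper n (λ t → h (nd t lf))))

∑-trees-graft : ∀ n h →
  ∑ (treesDepth (suc n)) (λ l → ∑ (treesDepth n) (λ r → atSize (suc n) h (nd l (nd r lf))))
  ≡ ∑ (trees n) (atGraft h)
∑-trees-graft n h = begin
  ∑ (treesDepth (suc n)) (λ l → ∑ (treesDepth n) (λ r → atSize (suc n) h (nd l (nd r lf))))
    ≡⟨ ∑-cong (λ l → ∑-cong (λ r → cong (λ k → 𝟙 (does (k ≟ suc n)) * h (nd l (nd r lf)))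
                                         (internal-graft l r))
                             (treesDepth n)) (treesDepth (suc n)) ⟩
  ∑ (treesDepth (suc n)) (λ l → ∑ (treesDepth n) (λ r → g (nd l r)))
    ≡⟨ ∑-treesDepth-stable n _ (λ l n<l → ∑-zero (λ r → atSize-≢ n (atGraft h) (nd l r)
         (>⇒≢ (≤-trans n<l (≤-trans (m≤m+n (internal l) (internal r)) (n≤1+n _))))) (treesDepth n)) ⟩
  ∑ (treesDepth n) (λ l → ∑ (treesDepth n) (λ r → g (nd l r)))
    ≡⟨ sym (trans (∑-treesDepth-suc n g)
                  (cong (_+ ∑ (treesDepth n) (λ l → ∑ (treesDepth n) (λ r → g (nd l r))))
                        (atSize-zero n (atGraft h) lf refl))) ⟩
  ∑ (treesDepth (suc n)) g
    ≡⟨ sym (∑-trees-deeper n (atGraft h)) ⟩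
  ∑ (trees n) (atGraft h) ∎
  where g = atSize n (atGraft h)

∑-trees-suc : ∀ n h → (∀ l r a b → h (nd l (nd r (nd a b))) ≡ 0) →
  ∑ (trees (suc n)) h ≡ ∑ (trees n) (λ t → h (nd t lf)) + ∑ (trees n) (atGraft h)
∑-trees-suc n h deep≡0 = begin
  ∑ (trees (suc n)) h
    ≡⟨ ∑-trees-deeper (suc n) h ⟩
  ∑ (treesDepth (suc (suc n))) H
    ≡⟨ ∑-treesDepth-suc (suc n) H ⟩
  ∑ (treesDepth (suc n)) (λ l → ∑ (treesDepth (suc n)) (λ r → H (nd l r)))
    ≡⟨ ∑-cong right-comb (treesDepth (suc n)) ⟩
  ∑ (treesDepth (suc n)) (λ l → H (nd l lf) + ∑ (treesDepth n) (λ r → H (nd l (nd r lf))))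
    ≡⟨ ∑-+ (treesDepth (suc n)) (λ l → H (nd l lf)) (λ l → ∑ (treesDepth n) (λ r → H (nd l (nd r lf))))
    ⟩
  ∑ (treesDepth (suc n)) (λ l → H (nd l lf))
    + ∑ (treesDepth (suc n)) (λ l → ∑ (treesDepth n) (λ r → H (nd l (nd r lf))))
    ≡⟨ cong₂ _+_ (∑-trees-root n h) (∑-trees-graft n h) ⟩
  ∑ (trees n) (λ t → h (nd t lf)) + ∑ (trees n) (atGraft h) ∎
  where
  H = atSize (suc n) h
  right-comb : ∀ l → ∑ (treesDepth (suc n)) (λ r → H (nd l r))
                   ≡ H (nd l lf) + ∑ (treesDepth n) (λ r → H (nd l (nd r lf)))
  right-comb l = trans (∑-treesDepth-suc n (λ r → H (nd l r))) (cong (H (nd l lf) +_)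
    (∑-cong (λ r → ∑-treesDepth-lf n (λ r′ → H (nd l (nd r r′)))
                     (λ a b → atSize-zero (suc n) h _ (deep≡0 l r a b))) (treesDepth n)))

leafChoices-graft : ∀ a l r →
  leafChoices a (nd l (nd r lf)) ≡ leafChoices a (nd l r) * (a + internal l + internal r)
leafChoices-graft a l r = sym (*-assoc (leafChoices a l) _ _)

rightHeight≤1-graft : ∀ l r →
  does (rightHeight (nd l (nd r lf)) ≤? 1) ≡ does (rightHeight (nd l r) ≤? 1)
rightHeight≤1-graft l lf       = ⊔1≤1 (rightHeight l)
  where
  ⊔1≤1 : ∀ h → does (h ⊔ 1 ≤? 1) ≡ does (h ≤? 1)
  ⊔1≤1 zero          = refl
  ⊔1≤1 (suc zero)    = refl
  ⊔1≤1 (suc (suc h)) = refl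
rightHeight≤1-graft l (nd _ _) = refl

rightHeight-deep : ∀ l r a b → 1 < rightHeight (nd l (nd r (nd a b)))
rightHeight-deep l r a b =
  ≤-trans (s≤s (≤-trans (s≤s z≤n) (m≤n⊔m (rightHeight r) _))) (m≤n⊔m (rightHeight l) _)

relaxedCount₁-root : ∀ t → relaxedCount₁ (nd t lf) ≡ relaxedCount₁ t * suc (internal t)
relaxedCount₁-root t = sym (*-assoc (𝟙 (does (rightHeight t ≤? 1))) _ _)

relaxedCount₁-graft : ∀ l r →
  relaxedCount₁ (nd l (nd r lf)) ≡ relaxedCount₁ (nd l r) * internal (nd l r)
relaxedCount₁-graft l r = begin
  𝟙 (does (rightHeight (nd l (nd r lf)) ≤? 1)) * leafChoices 1 (nd l (nd r lf))
    ≡⟨ cong₂ _*_ (cong 𝟙 (rightHeight≤1-graft l r)) (leafChoices-graft 1 l r) ⟩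
  𝟙 (does (rightHeight (nd l r) ≤? 1)) * (leafChoices 1 (nd l r) * internal (nd l r))
    ≡⟨ sym (*-assoc (𝟙 (does (rightHeight (nd l r) ≤? 1))) _ _) ⟩
  relaxedCount₁ (nd l r) * internal (nd l r) ∎

relaxedCount₁-deep : ∀ l r a b → relaxedCount₁ (nd l (nd r (nd a b))) ≡ 0
relaxedCount₁-deep l r a b =
  cong (λ b → 𝟙 b * leafChoices 1 t) (dec-false (rightHeight t ≤? 1) (<⇒≱ (rightHeight-deep l r a b)))
  where t = nd l (nd r (nd a b))

r₁-suc : ∀ n → r₁ (suc n) ≡ suc n * r₁ n + n * r₁ n
r₁-suc n = begin
  r₁ (suc n)
    ≡⟨ r₁≡∑ (suc n) ⟩
  ∑ (trees (suc n)) relaxedCount₁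
    ≡⟨ ∑-trees-suc n relaxedCount₁ relaxedCount₁-deep ⟩
  ∑ (trees n) (λ t → relaxedCount₁ (nd t lf)) + ∑ (trees n) (atGraft relaxedCount₁)
    ≡⟨ cong₂ _+_ (∑-trees-cong n new-root) (∑-trees-cong n new-right-leaf) ⟩
  ∑ (trees n) (λ t → suc n * relaxedCount₁ t) + ∑ (trees n) (λ t → n * relaxedCount₁ t)
    ≡⟨ cong₂ _+_ (∑-*ˡ (suc n) (trees n) relaxedCount₁) (∑-*ˡ n (trees n) relaxedCount₁) ⟩
  suc n * ∑ (trees n) relaxedCount₁ + n * ∑ (trees n) relaxedCount₁
    ≡⟨ cong (λ x → suc n * x + n * x) (sym (r₁≡∑ n)) ⟩
  suc n * r₁ n + n * r₁ n ∎
  where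
  new-root : ∀ t → internal t ≡ n → relaxedCount₁ (nd t lf) ≡ suc n * relaxedCount₁ t
  new-root t refl = trans (relaxedCount₁-root t) (*-comm (relaxedCount₁ t) _)
  new-right-leaf : ∀ t → internal t ≡ n → atGraft relaxedCount₁ t ≡ n * relaxedCount₁ t
  new-right-leaf lf       refl = refl
  new-right-leaf (nd l r) refl = trans (relaxedCount₁-graft l r) (*-comm (relaxedCount₁ (nd l r)) _)

dfact-odd : ∀ n → dfact (2 * suc n ∸ 1) ≡ dfact (suc (2 * n))
dfact-odd n = cong (λ m → dfact (m ∸ 1)) (*-suc 2 n)

dfact-suc : ∀ n → dfact (2 * suc n ∸ 1) ≡ 2 * n * dfact (2 * n ∸ 1) + dfact (2 * n ∸ 1)
dfact-suc zero    = refl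
dfact-suc (suc n) = begin
  dfact (2 * suc (suc n) ∸ 1)                 ≡⟨ dfact-odd (suc n) ⟩
  dfact (suc (2 * suc n))                     ≡⟨ cong (dfact ∘ suc) (*-suc 2 n) ⟩
  (3 + 2 * n) * dfact (suc (2 * n))           ≡⟨ odd-factor n (dfact (suc (2 * n))) ⟩
  2 * suc n * dfact (suc (2 * n)) + dfact (suc (2 * n))
    ≡⟨ cong (λ x → 2 * suc n * x + x) (sym (dfact-odd n)) ⟩
  2 * suc n * dfact (2 * suc n ∸ 1) + dfact (2 * suc n ∸ 1) ∎
  where
  odd-factor : ∀ n x → (3 + 2 * n) * x ≡ 2 * suc n * x + x
  odd-factor = solve-∀

r₁-recurrence : ∀ n → r₁ (suc n) ≡ 2 * n * r₁ n + r₁ n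
r₁-recurrence n = trans (r₁-suc n) (collect n (r₁ n))
  where
  collect : ∀ n x → suc n * x + n * x ≡ 2 * n * x + x
  collect = solve-∀

r₁≡dfact : ∀ n → r₁ n ≡ dfact (2 * n ∸ 1)
r₁≡dfact zero    = refl
r₁≡dfact (suc n) = begin
  r₁ (suc n)                                      ≡⟨ r₁-recurrence n ⟩
  2 * n * r₁ n + r₁ n                             ≡⟨ cong (λ x → 2 * n * x + x) (r₁≡dfact n) ⟩
  2 * n * dfact (2 * n ∸ 1) + dfact (2 * n ∸ 1)   ≡⟨ dfact-suc n ⟨
  dfact (2 * suc n ∸ 1)                           ∎

mainTheorem8 : (r₁ 0 ≡ 1)
    × (∀ (n : ℕ) → r₁ (suc n) ≡ 2 * n * r₁ n + r₁ n)
    × (∀ (n : ℕ) → r₁ n ≡ dfact (2 * n ∸ 1))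
mainTheorem8 = refl , r₁-recurrence , r₁≡dfact
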